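{- Let $q$ be an odd prime power, $d$ a positive integer, and $\varphi_d$ the coloring defined in the context. If $S = \{s_1, \ldots, s_t\} \subseteq (\mathbb{F}_q^*)^d$ is a $t$-falling star under $\varphi_d$, then $s_1, \ldots, s_{t-1}$ are linearly independent. Consequently, for every subset $T \subseteq (\mathbb{F}_q^*)^d$, $\mathrm{rk}(T) \geq \mathrm{FS}(T) - 1$. Moreover, if $T$ is contained in a monochromatic neighborhood of some vector $v \in (\mathbb{F}_q^*)^d \setminus T$ (i.e. there is a color $\gamma$ with $\varphi_d(v,x) = \gamma$ for all $x \in T$), then $\mathrm{rk}(T) \geq \mathrm{FS}(T)$.
   Context: $\mathbb{F}_q^*$ is the set of nonzero elements of $\mathbb{F}_q$, with an arbitrary fixed linear order; $(\mathbb{F}_q^*)^d$ is ordered lexicographically. $C_d = \mathrm{DOT} \sqcup \mathrm{ZERO} \sqcup \mathrm{UP} \sqcup \mathrm{DOWN}$, with $\mathrm{DOT} = \mathbb{F}_q^*$ and ZERO, UP, DOWN disjoint copies of $\{1,\ldots,d\}\times\mathbb{F}_q$. For distinct $x<y$, with $i$ the first coordinate where they differ and $\cdot$ the standard dot product, $\varphi_d(x,y)=\varphi_d(y,x)$ equals $(i,x_i+y_i)_{\mathrm{ZERO}}$ if $x\cdot y=0$; $(i,x_i+y_i)_{\mathrm{UP}}$ if $x\cdot y\neq 0$ and $x\cdot y = x\cdot x$; $(i,x_i+y_i)_{\mathrm{DOWN}}$ if $x\cdot y\notin\{0,x\cdot x\}$ and $x\cdot y = y\cdot y$; and $x\cdot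 y\in\mathrm{DOT}$ otherwise. A set of distinct vectors $\{s_1,\ldots,s_t\}$ is a $t$-falling star under $\varphi_d$ if there are colors $\alpha_2, \ldots, \alpha_t$ with $\varphi_d(s_i, s_j) = \alpha_i$ for all $1 \leq j < i \leq t$. $\mathrm{FS}(T)$ is the maximum $t$ such that $T$ contains a $t$-falling star. $\mathrm{rk}(T)$ is the dimension of the linear span of $T$. -}

module Defs where

open import Level using (0ℓ)
open import Data.Nat as ℕ using (ℕ; zero; suc; _^_; _≤_; _<_)
open import Data.Nat.Primality using (Prime)
open import Data.Fin as Fin using (Fin)
open import Data.Fin.Properties using (_≟_)
open import Data.Vec using (Vec; []; _∷_)
open import Data.Bool using (Bool; true; false; if_then_else_)
open import Data.Maybe using (Maybe; just; nothing)
open import Data.Product using (Σ; ∃; ∃-syntax; _×_; _,_)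
open import Relation.Binary.PropositionalEquality using (_≡_; _≢_)
open import Relation.Nullary.Decidable using (⌊_⌋; yes; no)
open import Relation.Unary using (Pred)
open import Function.Definitions using (Injective)
open import Algebra.Structures using (IsCommutativeRing)

OddPrimePower : ℕ → Set
OddPrimePower q = ∃[ p ] ∃[ k ] (Prime p × (p ℕ.% 2 ≡ 1) × (1 ≤ k) × (q ≡ p ^ k))

-- The fixed linear order on F_q^* is the
-- order of Fin q restricted to the nonzero elements; since the field structure
-- on Fin q is arbitrary, every linear order on F_q^* arises this way.
record FieldOn (q : ℕ) : Set where
  field
    _+_ _*_ : Fin q → Fin q → Fin q
    -_      : Fin q → Fin q
    0# 1#   : Fin q
    isCommutativeRing : IsCommutativeRing _≡_ _+_ _*_ -_ 0# 1#
    0≢1     : 0# ≢ 1#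
    inverse : ∀ x → x ≢ 0# → ∃[ y ] (x * y ≡ 1#)

module _ {q : ℕ} (F : FieldOn q) where
  open FieldOn F

  V : ℕ → Set
  V d = Vec (Fin q) d

  data AllNonzero : {d : ℕ} → V d → Set where
    []  : AllNonzero []
    _∷_ : ∀ {d a} {xs : V d} → a ≢ 0# → AllNonzero xs → AllNonzero (a ∷ xs)

  dot : {d : ℕ} → V d → V d → Fin q
  dot []       []       = 0#
  dot (a ∷ xs) (b ∷ ys) = (a * b) + dot xs ys

  zeroV : (d : ℕ) → V d
  zeroV zero    = []
  zeroV (suc d) = 0# ∷ zeroV d

  _+V_ : {d : ℕ} → V d → V d → V d
  []       +V []       = []
  (a ∷ xs) +V (b ∷ ys) = (a + b) ∷ (xs +V ys)

  _·V_ : {d : ℕ} → Fin q → V d → V d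
  c ·V []       = []
  c ·V (a ∷ xs) = (c * a) ∷ (c ·V xs)

  lincomb : {d m : ℕ} → (Fin m → Fin q) → (Fin m → V d) → V d
  lincomb {d} {zero}  c x = zeroV d
  lincomb {d} {suc m} c x = (c Fin.zero ·V x Fin.zero) +V lincomb (λ k → c (Fin.suc k)) (λ k → x (Fin.suc k))

  LinIndep : {d m : ℕ} → (Fin m → V d) → Set
  LinIndep {d} {m} x = ∀ (c : Fin m → Fin q) → lincomb c x ≡ zeroV d → ∀ k → c k ≡ 0#

  data Color (d : ℕ) : Set where
    DOT  : Fin q → Color d
    ZERO : Fin d → Fin q → Color d
    UP   : Fin d → Fin q → Color d
    DOWN : Fin d → Fin q → Color d

  firstDiff : {d : ℕ} → V d → V d → Maybe (Fin d × Fin q × Fin q)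
  firstDiff []       []       = nothing
  firstDiff (a ∷ xs) (b ∷ ys) with a ≟ b
  ... | yes _ with firstDiff xs ys
  ...   | nothing            = nothing
  ...   | just (i , a' , b') = just (Fin.suc i , a' , b')
  firstDiff (a ∷ xs) (b ∷ ys) | no _ = just (Fin.zero , a , b)

  -- color of the pair x < y (lexicographically), i = first differing coordinate, s = x_i + y_i
  colorOrdered : {d : ℕ} → V d → V d → Fin d → Fin q → Color d
  colorOrdered x y i s =
    if ⌊ dot x y ≟ 0# ⌋ then ZERO i s
    else if ⌊ dot x y ≟ dot x x ⌋ then UP i s
    else if ⌊ dot x y ≟ dot y y ⌋ then DOWN i s
    else DOT (dot x y)

  -- the coloring φ_d (symmetric); its value on equal vectors is irrelevant
  φ : {d : ℕ} → V d → V d → Color d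
  φ x y with firstDiff x y
  ... | nothing          = DOT 0#
  ... | just (i , a , b) =
        if ⌊ Fin.toℕ a ℕ.<? Fin.toℕ b ⌋ then colorOrdered x y i (a + b)
        else colorOrdered y x i (a + b)

  FallingStar : {d t : ℕ} → (Fin t → V d) → Set
  FallingStar {d} {t} s =
    Injective _≡_ _≡_ s ×
    Σ (Fin t → Color d) (λ α → ∀ (i j : Fin t) → j Fin.< i → φ (s i) (s j) ≡ α i)

  InSet : {d m : ℕ} → Pred (V d) 0ℓ → (Fin m → V d) → Set
  InSet T x = ∀ k → T (x k)

  InSpan : {d : ℕ} → Pred (V d) 0ℓ → V d → Set
  InSpan {d} T v = ∃[ m ] Σ (Fin m → V d) λ x → InSet T x × ∃[ c ] (lincomb c x ≡ v)

  IsRank : {d : ℕ} → Pred (V d) 0ℓ → ℕ → Set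
  IsRank {d} T r = Σ (Fin r → V d) λ b →
    LinIndep b × (∀ k → InSpan T (b k)) × (∀ v → T v → ∃[ c ] (lincomb c b ≡ v))

  IsFS : {d : ℕ} → Pred (V d) 0ℓ → ℕ → Set
  IsFS {d} T f =
    (Σ (Fin f → V d) λ s → InSet T s × FallingStar s) ×
    (∀ t (s : Fin t → V d) → InSet T s → FallingStar s → t ≤ f)

  SubsetNonzero : {d : ℕ} → Pred (V d) 0ℓ → Set
  SubsetNonzero T = ∀ x → T x → AllNonzero x

-- Let x_j = s_j for j < t and y = s_t. A colour at a fixed vertex y is cut out by linear
-- conditions: φ(y,z) = DOT c forces y·z = c, and a colour (i , σ) of type ZERO, UP or DOWN
-- forces z_i = σ - y_i with z agreeing with y before i. So all x_j lie on one affine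
-- hyperplane ℓ = λ with λ ≠ 0 (ℓ is y·_ or the first coordinate), and the colour of row m
-- puts x_0, …, x_{m-1} on a level set of a linear form that takes another value at x_m.
-- Such points are linearly independent. The rank bounds follow because independent vectors
-- in the span of r vectors number at most r; in the last part the outside vector v plays
-- the role of y, so all FS(T) star vectors are independent.
module Submission where

open import Defs
open import Level using (0ℓ)
open import Data.Nat using (ℕ; suc; _≤_; _∸_)
open import Data.Fin using (Fin; inject₁)
open import Data.Product using (_×_)
open import Relation.Binary.PropositionalEquality using (_≡_)
open import Relation.Nullary using (¬_)
open import Relation.Unary using (Pred)

open import Algebra.Bundles using (CommutativeRing)
import Algebra.Properties.CommutativeSemigroup as CommutativeSemigroupProperties
import Algebra.Properties.Group as GroupProperties
import Algebra.Properties.Ring as RingProperties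
import Algebra.Properties.Semiring.Sum as SemiringSum
open import Data.Empty using (⊥-elim)
open import Data.Fin as Fin using (zero; suc; punchIn)
import Data.Fin.Induction as Finᵢ
import Data.Fin.Properties as Finₚ
open import Data.Maybe using (just; nothing)
open import Data.Nat as ℕ using (zero; suc)
import Data.Nat.Properties as ℕₚ
open import Data.Product using (Σ; ∃-syntax; _,_; proj₁; proj₂)
open import Data.Sum using (_⊎_; inj₁; inj₂)
open import Data.Vec using ([]; _∷_; lookup)
open import Data.Vec.Properties using (tabulate∘lookup; tabulate-cong)
open import Data.Vec.Functional using (removeAt; insertAt)
open import Data.Vec.Functional.Properties using (insertAt-lookup; insertAt-punchIn)
import Induction.WellFounded as WF
open import Relation.Binary.Definitions using (tri<; tri≈; tri>)
open import Relation.Binary.PropositionalEquality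
  using (_≢_; refl; sym; trans; cong; cong₂; subst; subst₂; module ≡-Reasoning)
open import Relation.Nullary using (yes; no)

module _ {q : ℕ} (F : FieldOn q) where
  open FieldOn F renaming (_+_ to infixl 6 _+_; _*_ to infixl 7 _*_; -_ to infix 8 -_)

  ring : CommutativeRing 0ℓ 0ℓ
  ring = record
    { Carrier = Fin q ; _≈_ = _≡_ ; _+_ = _+_ ; _*_ = _*_ ; -_ = -_ ; 0# = 0# ; 1# = 1#
    ; isCommutativeRing = isCommutativeRing }

  open CommutativeRing ring
    using (+-comm; +-identityˡ; +-identityʳ; -‿inverseʳ; *-assoc; *-comm; *-identityʳ;
           distribˡ; zeroˡ; zeroʳ; semiring; +-group; +-commutativeSemigroup)
  open SemiringSum semiring
    using (sum; sum-syntax; sum-cong-≗; sum-remove; sum-replicate-zero; ∑-distrib-+; ∑-comm;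
           *-distribˡ-sum; *-distribʳ-sum)
  open GroupProperties +-group using (y≈x\\z; x∙y⁻¹≈ε⇒x≈y)
  open RingProperties (CommutativeRing.ring ring) using (-‿distribˡ-*)
  open CommutativeSemigroupProperties +-commutativeSemigroup using (interchange)
  open ≡-Reasoning

  x*y≡0⇒x≡0 : ∀ {x y} → y ≢ 0# → x * y ≡ 0# → x ≡ 0#
  x*y≡0⇒x≡0 {x} {y} y≢0 xy≡0 with inverse y y≢0
  ... | y⁻¹ , yy⁻¹≡1 = begin
    x               ≡⟨ sym (*-identityʳ x) ⟩
    x * 1#          ≡⟨ cong (x *_) (sym yy⁻¹≡1) ⟩
    x * (y * y⁻¹)   ≡⟨ sym (*-assoc x y y⁻¹) ⟩
    x * y * y⁻¹     ≡⟨ cong (_* y⁻¹) xy≡0 ⟩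
    0# * y⁻¹        ≡⟨ zeroˡ y⁻¹ ⟩
    0#              ∎

  sum-zero : ∀ {n} (g : Fin n → Fin q) → (∀ j → g j ≡ 0#) → sum g ≡ 0#
  sum-zero {n} g g≡0 = trans (sum-cong-≗ g≡0) (sum-replicate-zero n)

  sum-single : ∀ {n} (g : Fin n → Fin q) (m : Fin n) → (∀ j → j ≢ m → g j ≡ 0#) → sum g ≡ g m
  sum-single {suc n} g m g≡0 = begin
    sum g                       ≡⟨ sum-remove {i = m} g ⟩
    g m + sum (removeAt g m)    ≡⟨ cong (g m +_) (sum-zero _ (λ j → g≡0 (punchIn m j) (Finₚ.punchInᵢ≢i m j))) ⟩
    g m + 0#                    ≡⟨ +-identityʳ (g m) ⟩
    g m                         ∎

  lookup-extensionality : ∀ {d} {u v : V F d} → (∀ k → lookup u k ≡ lookup v k) → u ≡ v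
  lookup-extensionality {u = u} {v} u≗v =
    trans (sym (tabulate∘lookup u)) (trans (tabulate-cong u≗v) (tabulate∘lookup v))

  record LinearForm (d : ℕ) : Set where
    field
      apply  : V F d → Fin q
      +-homo : ∀ u v → apply (_+V_ F u v) ≡ apply u + apply v
      ·-homo : ∀ a v → apply (_·V_ F a v) ≡ a * apply v
      0-homo : apply (zeroV F d) ≡ 0#

    apply-lincomb : ∀ {m} (c : Fin m → Fin q) (x : Fin m → V F d) →
                    apply (lincomb F c x) ≡ ∑[ j < m ] (c j * apply (x j))
    apply-lincomb {zero}  c x = 0-homo
    apply-lincomb {suc m} c x =
      trans (+-homo _ _) (cong₂ _+_ (·-homo _ _) (apply-lincomb (λ j → c (suc j)) (λ j → x (suc j))))

  open LinearForm

  coordinate : ∀ {d} → Fin d → LinearForm d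
  coordinate k = record { apply = λ v → lookup v k ; +-homo = +-homo′ k ; ·-homo = ·-homo′ k ; 0-homo = 0-homo′ k }
    where
    +-homo′ : ∀ {d} (k : Fin d) u v → lookup (_+V_ F u v) k ≡ lookup u k + lookup v k
    +-homo′ zero    (a ∷ u) (b ∷ v) = refl
    +-homo′ (suc k) (a ∷ u) (b ∷ v) = +-homo′ k u v
    ·-homo′ : ∀ {d} (k : Fin d) a v → lookup (_·V_ F a v) k ≡ a * lookup v k
    ·-homo′ zero    a (b ∷ v) = refl
    ·-homo′ (suc k) a (b ∷ v) = ·-homo′ k a v
    0-homo′ : ∀ {d} (k : Fin d) → lookup (zeroV F d) k ≡ 0#
    0-homo′ zero    = refl
    0-homo′ (suc k) = 0-homo′ k

  dotWith : ∀ {d} → V F d → LinearForm d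
  dotWith u = record { apply = dot F u ; +-homo = +-homo′ u ; ·-homo = ·-homo′ u ; 0-homo = 0-homo′ u }
    where
    +-homo′ : ∀ {d} (u v w : V F d) → dot F u (_+V_ F v w) ≡ dot F u v + dot F u w
    +-homo′ []      []      []      = sym (+-identityˡ 0#)
    +-homo′ (a ∷ u) (b ∷ v) (c ∷ w) =
      trans (cong₂ _+_ (distribˡ a b c) (+-homo′ u v w)) (interchange _ _ _ _)
    ·-homo′ : ∀ {d} (u : V F d) e v → dot F u (_·V_ F e v) ≡ e * dot F u v
    ·-homo′ []      e []      = sym (zeroʳ e)
    ·-homo′ (a ∷ u) e (b ∷ v) = begin
      a * (e * b) + dot F u (_·V_ F e v)  ≡⟨ cong₂ _+_ (sym (*-assoc a e b)) (·-homo′ u e v) ⟩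
      a * e * b + e * dot F u v            ≡⟨ cong (λ z → z * b + e * dot F u v) (*-comm a e) ⟩
      e * a * b + e * dot F u v            ≡⟨ cong (_+ e * dot F u v) (*-assoc e a b) ⟩
      e * (a * b) + e * dot F u v          ≡⟨ sym (distribˡ e _ _) ⟩
      e * (a * b + dot F u v)              ∎
    0-homo′ : ∀ {d} (u : V F d) → dot F u (zeroV F d) ≡ 0#
    0-homo′ []      = refl
    0-homo′ (a ∷ u) = trans (cong₂ _+_ (zeroʳ a) (0-homo′ u)) (+-identityˡ 0#)

  OnAffineHyperplane : ∀ {d t} → (Fin t → V F d) → Set
  OnAffineHyperplane {d} x =
    Σ (LinearForm d) λ ℓ → ∃[ λ₀ ] λ₀ ≢ 0# × (∀ j → apply ℓ (x j) ≡ λ₀)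

  SeparatedFromPredecessors : ∀ {d t} → (Fin t → V F d) → Fin t → Set
  SeparatedFromPredecessors {d} x m =
    Σ (LinearForm d) λ ℓ → ∃[ w ] (∀ j → j Fin.< m → apply ℓ (x j) ≡ w) × apply ℓ (x m) ≢ w

  -- A relation Σ c_j x_j = 0 has Σ c_j = 0 by the hyperplane; then downwards from the
  -- top, the form separating x_m kills every term except c_m (ℓ(x_m) - w).
  affinelySeparated⇒linIndep : ∀ {d t} (x : Fin t → V F d) → OnAffineHyperplane x →
                               (∀ m → SeparatedFromPredecessors x m) → LinIndep F x
  affinelySeparated⇒linIndep {d} {t} x (ℓ , λ₀ , λ₀≢0 , ℓx≡λ₀) separated c relation =
    WF.All.wfRec Finᵢ.>-wellFounded 0ℓ (λ m → c m ≡ 0#) vanishes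
    where
    apply-relation : ∀ ℓ′ → ∑[ j < t ] (c j * apply ℓ′ (x j)) ≡ 0#
    apply-relation ℓ′ =
      trans (sym (apply-lincomb ℓ′ c x)) (trans (cong (apply ℓ′) relation) (0-homo ℓ′))

    sum-coefficients : sum c ≡ 0#
    sum-coefficients = x*y≡0⇒x≡0 λ₀≢0 (begin
      sum c * λ₀                      ≡⟨ *-distribʳ-sum λ₀ c ⟩
      ∑[ j < t ] (c j * λ₀)           ≡⟨ sum-cong-≗ (λ j → cong (c j *_) (sym (ℓx≡λ₀ j))) ⟩
      ∑[ j < t ] (c j * apply ℓ (x j)) ≡⟨ apply-relation ℓ ⟩
      0#                              ∎)

    vanishes : ∀ m → (∀ {j} → m Fin.< j → c j ≡ 0#) → c m ≡ 0#
    vanishes m c>m≡0 with separated m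
    ... | ℓ′ , w , ℓ′x<m≡w , ℓ′xm≢w =
      x*y≡0⇒x≡0 (λ eq → ℓ′xm≢w (x∙y⁻¹≈ε⇒x≈y _ _ eq)) (trans (sym (sum-single g m g≡0)) sum-g)
      where
      g : Fin t → Fin q
      g j = c j * (apply ℓ′ (x j) + - w)

      g≡0 : ∀ j → j ≢ m → g j ≡ 0#
      g≡0 j j≢m with Finₚ.<-cmp j m
      ... | tri< j<m _ _ = trans (cong (λ z → c j * (z + - w)) (ℓ′x<m≡w j j<m))
                                 (trans (cong (c j *_) (-‿inverseʳ w)) (zeroʳ (c j)))
      ... | tri≈ _ j≡m _ = ⊥-elim (j≢m j≡m)
      ... | tri> _ _ j>m = trans (cong (_* _) (c>m≡0 j>m)) (zeroˡ _)

      sum-g : sum g ≡ 0#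
      sum-g = begin
        sum g                                                  ≡⟨ sum-cong-≗ (λ j → distribˡ (c j) _ _) ⟩
        ∑[ j < t ] (c j * apply ℓ′ (x j) + c j * - w)          ≡⟨ ∑-distrib-+ (λ j → c j * apply ℓ′ (x j)) (λ j → c j * - w) ⟩
        ∑[ j < t ] (c j * apply ℓ′ (x j)) + ∑[ j < t ] (c j * - w)
                                                               ≡⟨ cong₂ _+_ (apply-relation ℓ′) (sym (*-distribʳ-sum (- w) c)) ⟩
        0# + sum c * - w                                       ≡⟨ cong (λ z → 0# + z * - w) sum-coefficients ⟩
        0# + 0# * - w                                          ≡⟨ trans (+-identityˡ _) (zeroˡ (- w)) ⟩
        0#                                                     ∎

  record FirstDifference {d} (x y : V F d) (k : Fin d) : Set where
    constructor _,_
    field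
      differs      : lookup x k ≢ lookup y k
      agree-before : ∀ l → l Fin.< k → lookup x l ≡ lookup y l

  FirstDifference-sym : ∀ {d} {x y : V F d} {k} → FirstDifference x y k → FirstDifference y x k
  FirstDifference-sym (xk≢yk , agree) = (λ eq → xk≢yk (sym eq)) , (λ l l<k → sym (agree l l<k))

  firstDiff-nothing : ∀ {d} {x y : V F d} → firstDiff F x y ≡ nothing → x ≡ y
  firstDiff-nothing {x = []}    {[]}    _  = refl
  firstDiff-nothing {x = a ∷ x} {b ∷ y} eq with a Finₚ.≟ b
  ... | yes a≡b with firstDiff F x y in eq′
  ...   | nothing = cong₂ _∷_ a≡b (firstDiff-nothing {x = x} {y} eq′)
  firstDiff-nothing {x = a ∷ x} {b ∷ y} () | no _

  firstDiff-just : ∀ {d} {x y : V F d} {k a b} → firstDiff F x y ≡ just (k , a , b) →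
                   lookup x k ≡ a × lookup y k ≡ b × FirstDifference x y k
  firstDiff-just {x = a ∷ x} {b ∷ y} eq with a Finₚ.≟ b
  firstDiff-just {x = a ∷ x} {b ∷ y} refl | no a≢b = refl , refl , (a≢b , λ _ ())
  ... | yes a≡b with firstDiff F x y in eq′
  firstDiff-just {x = a ∷ x} {b ∷ y} refl | yes a≡b | just (k , _ , _)
    with firstDiff-just {x = x} {y} eq′
  ...   | xk≡ , yk≡ , (xk≢yk , agree) = xk≡ , yk≡ , (xk≢yk , agree′)
    where
    agree′ : ∀ l → l Fin.< suc k → lookup (a ∷ x) l ≡ lookup (b ∷ y) l
    agree′ zero    _           = a≡b
    agree′ (suc l) (ℕ.s≤s l<k) = agree l l<k

  Shape : ℕ → Set
  Shape d = Fin q ⊎ (Fin d × Fin q)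

  shape : ∀ {d} → Color F d → Shape d
  shape (DOT c)    = inj₁ c
  shape (ZERO k σ) = inj₂ (k , σ)
  shape (UP k σ)   = inj₂ (k , σ)
  shape (DOWN k σ) = inj₂ (k , σ)

  Consistent : ∀ {d} → V F d → V F d → Shape d → Set
  Consistent x y (inj₁ c)       = dot F x y ≡ c × c ≢ 0# × c ≢ dot F x x × c ≢ dot F y y
  Consistent x y (inj₂ (k , σ)) = FirstDifference x y k × lookup x k + lookup y k ≡ σ

  dot-comm : ∀ {d} (x y : V F d) → dot F x y ≡ dot F y x
  dot-comm []      []      = refl
  dot-comm (a ∷ x) (b ∷ y) = cong₂ _+_ (*-comm a b) (dot-comm x y)

  Consistent-sym : ∀ {d} {x y : V F d} κ → Consistent y x κ → Consistent x y κ
  Consistent-sym {x = x} {y} (inj₁ c) (yx≡c , c≢0 , c≢yy , c≢xx) =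
    trans (dot-comm x y) yx≡c , c≢0 , c≢xx , c≢yy
  Consistent-sym (inj₂ (k , σ)) (difference , sum) =
    FirstDifference-sym difference , trans (+-comm _ _) sum

  colorOrdered-consistent : ∀ {d} {x y : V F d} {k σ} → FirstDifference x y k →
                            lookup x k + lookup y k ≡ σ → Consistent x y (shape (colorOrdered F x y k σ))
  colorOrdered-consistent {x = x} {y} difference sum with dot F x y Finₚ.≟ 0#
  ... | yes _ = difference , sum
  ... | no xy≢0 with dot F x y Finₚ.≟ dot F x x
  ...   | yes _ = difference , sum
  ...   | no xy≢xx with dot F x y Finₚ.≟ dot F y y
  ...     | yes _    = difference , sum
  ...     | no xy≢yy = refl , xy≢0 , xy≢xx , xy≢yy

  φ-consistent : ∀ {d} {x y : V F d} → x ≢ y → Consistent x y (shape (φ F x y))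
  φ-consistent {x = x} {y} x≢y with firstDiff F x y in eq
  ... | nothing = ⊥-elim (x≢y (firstDiff-nothing {x = x} {y} eq))
  ... | just (k , a , b) with firstDiff-just {x = x} {y} eq
  ...   | refl , refl , difference with Fin.toℕ (lookup x k) ℕ.<? Fin.toℕ (lookup y k)
  ...     | yes _ = colorOrdered-consistent difference refl
  ...     | no _  = Consistent-sym _ (colorOrdered-consistent (FirstDifference-sym difference) (+-comm _ _))

  rowForm : ∀ {d} → V F d → Shape d → LinearForm d
  rowForm y (inj₁ _)       = dotWith y
  rowForm y (inj₂ (k , _)) = coordinate k

  rowValue : ∀ {d} → V F d → Shape d → Fin q
  rowValue y (inj₁ c)       = c
  rowValue y (inj₂ (k , σ)) = - lookup y k + σ

  rowForm-value : ∀ {d} {y z : V F d} κ → Consistent y z κ → apply (rowForm y κ) z ≡ rowValue y κ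
  rowForm-value         (inj₁ c)       (yz≡c , _) = yz≡c
  rowForm-value {y = y} (inj₂ (k , σ)) (_ , sum)  = y≈x\\z (lookup y k) _ σ sum

  rowForm-separates : ∀ {d} {y z : V F d} κ → Consistent y z κ → apply (rowForm y κ) y ≢ rowValue y κ
  rowForm-separates (inj₁ c)       (_ , _ , c≢yy , _)       yy≡c = c≢yy (sym yy≡c)
  rowForm-separates (inj₂ (k , σ)) consistent@(difference , _) yk≡v =
    FirstDifference.differs difference (trans yk≡v (sym (rowForm-value (inj₂ (k , σ)) consistent)))

  -- For a colour (i , σ) either i = 0 and z₀ = σ - y₀, or z agrees with y at coordinate 0.
  levelForm : ∀ {d} → V F (suc d) → Shape (suc d) → LinearForm (suc d)
  levelForm y (inj₁ _) = dotWith y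
  levelForm y (inj₂ _) = coordinate zero

  levelValue : ∀ {d} → V F (suc d) → Shape (suc d) → Fin q
  levelValue y (inj₁ c)            = c
  levelValue y (inj₂ (zero , σ))   = - lookup y zero + σ
  levelValue y (inj₂ (suc _ , _))  = lookup y zero

  levelForm-value : ∀ {d} {y z : V F (suc d)} κ → Consistent y z κ → apply (levelForm y κ) z ≡ levelValue y κ
  levelForm-value         (inj₁ c)           (yz≡c , _)       = yz≡c
  levelForm-value {y = y} (inj₂ (zero , σ))  (_ , sum)        = y≈x\\z (lookup y zero) _ σ sum
  levelForm-value         (inj₂ (suc k , σ)) ((_ , agree) , _) = sym (agree zero ℕ.z<s)

  AllNonzero-head : ∀ {d} {y : V F (suc d)} → AllNonzero F y → lookup y zero ≢ 0#
  AllNonzero-head (y₀≢0 ∷ _) = y₀≢0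

  levelValue≢0 : ∀ {d} {y z : V F (suc d)} κ → AllNonzero F y → AllNonzero F z → Consistent y z κ →
                 levelValue y κ ≢ 0#
  levelValue≢0 (inj₁ c)           _     _     (_ , c≢0 , _) = c≢0
  levelValue≢0 (inj₂ (zero , σ))  _     z≢0   consistent    =
    λ v≡0 → AllNonzero-head z≢0 (trans (levelForm-value (inj₂ (zero , σ)) consistent) v≡0)
  levelValue≢0 (inj₂ (suc _ , _)) y≢0   _     _             = AllNonzero-head y≢0

  fallingStar-with-apex⇒linIndep :
    ∀ {d t} (x : Fin t → V F (suc d)) (y : V F (suc d)) (γ : Color F (suc d)) →
    (∀ j → AllNonzero F (x j)) → AllNonzero F y → FallingStar F x →
    (∀ j → y ≢ x j) → (∀ j → φ F y (x j) ≡ γ) → LinIndep F x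
  fallingStar-with-apex⇒linIndep {t = zero} _ _ _ _ _ _ _ _ _ _ ()
  fallingStar-with-apex⇒linIndep {t = suc t} x y γ x≢0 y≢0 (injective , α , falling) y≢x monochromatic =
    affinelySeparated⇒linIndep x hyperplane separated
    where
    row-consistent : ∀ {i j} → j Fin.< i → Consistent (x i) (x j) (shape (α i))
    row-consistent {i} {j} j<i =
      subst (λ γ′ → Consistent (x i) (x j) (shape γ′)) (falling i j j<i)
            (φ-consistent (λ xi≡xj → Finₚ.<-irrefl (sym (injective xi≡xj)) j<i))

    apex-consistent : ∀ j → Consistent y (x j) (shape γ)
    apex-consistent j = subst (λ γ′ → Consistent y (x j) (shape γ′)) (monochromatic j) (φ-consistent (y≢x j))

    level≢0 : levelValue y (shape γ) ≢ 0#
    level≢0 = levelValue≢0 (shape γ) y≢0 (x≢0 zero) (apex-consistent zero)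

    hyperplane : OnAffineHyperplane x
    hyperplane = levelForm y (shape γ) , levelValue y (shape γ) , level≢0 ,
                 λ j → levelForm-value (shape γ) (apex-consistent j)

    separated : ∀ m → SeparatedFromPredecessors x m
    separated zero =
      levelForm y (shape γ) , 0# , (λ _ ()) ,
      λ x₀≡0 → level≢0 (trans (sym (levelForm-value (shape γ) (apex-consistent zero))) x₀≡0)
    separated (suc m) =
      rowForm (x (suc m)) (shape (α (suc m))) , rowValue (x (suc m)) (shape (α (suc m))) ,
      (λ j j<m → rowForm-value (shape (α (suc m))) (row-consistent j<m)) ,
      rowForm-separates (shape (α (suc m))) (row-consistent {suc m} {zero} ℕ.z<s)

  RowRelation : ∀ {m r} → (Fin m → Fin r → Fin q) → (Fin m → Fin q) → Set
  RowRelation {m} M c = ∀ k → ∑[ i < m ] (c i * M i k) ≡ 0#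

  Nontrivial : ∀ {m} → (Fin m → Fin q) → Set
  Nontrivial c = ∃[ i ] c i ≢ 0#

  sum-insertAt : ∀ {m} (d ν : Fin m → Fin q) (p : Fin (suc m)) (u : Fin (suc m) → Fin q) →
                 ∑[ j < suc m ] (insertAt d p (∑[ i < m ] (d i * ν i)) j * u j)
                   ≡ ∑[ i < m ] (d i * (u (punchIn p i) + ν i * u p))
  sum-insertAt {m} d ν p u = begin
    ∑[ j < suc m ] (c j * u j)                                          ≡⟨ sum-remove {i = p} (λ j → c j * u j) ⟩
    c p * u p + ∑[ i < m ] (c (punchIn p i) * u (punchIn p i))          ≡⟨ cong₂ (λ a b → a * u p + b)
                                                                             (insertAt-lookup d p _)
                                                                             (sum-cong-≗ (λ i → cong (_* _) (insertAt-punchIn d p _ i))) ⟩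
    ∑[ i < m ] (d i * ν i) * u p + ∑[ i < m ] (d i * u (punchIn p i))   ≡⟨ cong (_+ _) (*-distribʳ-sum (u p) (λ i → d i * ν i)) ⟩
    ∑[ i < m ] (d i * ν i * u p) + ∑[ i < m ] (d i * u (punchIn p i))   ≡⟨ sym (∑-distrib-+ (λ i → d i * ν i * u p) _) ⟩
    ∑[ i < m ] (d i * ν i * u p + d i * u (punchIn p i))                ≡⟨ sum-cong-≗ factor ⟩
    ∑[ i < m ] (d i * (u (punchIn p i) + ν i * u p))                    ∎
    where
    c = insertAt d p (∑[ i < m ] (d i * ν i))
    factor : ∀ i → d i * ν i * u p + d i * u (punchIn p i) ≡ d i * (u (punchIn p i) + ν i * u p)
    factor i = trans (+-comm _ _) (trans (cong (d i * u (punchIn p i) +_) (*-assoc (d i) (ν i) (u p)))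
                                         (sym (distribˡ (d i) _ _)))

  -- Gaussian elimination on the first column, with pivot row p.
  pivot-relation : ∀ {m r} (M : Fin (suc m) → Fin (suc r) → Fin q) (p : Fin (suc m)) (a⁻¹ : Fin q) →
                   M p zero * a⁻¹ ≡ 1# → (d : Fin m → Fin q) → Nontrivial d →
                   RowRelation (λ i k → M (punchIn p i) (suc k) + - (M (punchIn p i) zero * a⁻¹) * M p (suc k)) d →
                   ∃[ c ] Nontrivial c × RowRelation M c
  pivot-relation {m} M p a⁻¹ aa⁻¹≡1 d (i₀ , dᵢ₀≢0) reduced-relation =
    c , (punchIn p i₀ , λ cᵢ₀≡0 → dᵢ₀≢0 (trans (sym (insertAt-punchIn d p _ i₀)) cᵢ₀≡0)) , relation
    where
    ν : Fin m → Fin q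
    ν i = - (M (punchIn p i) zero * a⁻¹)
    c = insertAt d p (∑[ i < m ] (d i * ν i))

    eliminated : ∀ i → M (punchIn p i) zero + ν i * M p zero ≡ 0#
    eliminated i = begin
      e + - (e * a⁻¹) * a     ≡⟨ cong (e +_) (sym (-‿distribˡ-* (e * a⁻¹) a)) ⟩
      e + - (e * a⁻¹ * a)     ≡⟨ cong (λ z → e + - z) (*-assoc e a⁻¹ a) ⟩
      e + - (e * (a⁻¹ * a))   ≡⟨ cong (λ z → e + - (e * z)) (trans (*-comm a⁻¹ a) aa⁻¹≡1) ⟩
      e + - (e * 1#)          ≡⟨ cong (λ z → e + - z) (*-identityʳ e) ⟩
      e + - e                 ≡⟨ -‿inverseʳ e ⟩
      0#                      ∎
      where
      e = M (punchIn p i) zero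
      a = M p zero

    relation : RowRelation M c
    relation zero    = trans (sum-insertAt d ν p (λ j → M j zero))
                             (sum-zero _ (λ i → trans (cong (d i *_) (eliminated i)) (zeroʳ (d i))))
    relation (suc k) = trans (sum-insertAt d ν p (λ j → M j (suc k))) (reduced-relation k)

  more-rows-than-columns⇒relation : ∀ {m r} → r ℕ.< m → (M : Fin m → Fin r → Fin q) →
                                    ∃[ c ] Nontrivial c × RowRelation M c
  more-rows-than-columns⇒relation {suc m} {zero} _ M = (λ _ → 1#) , (zero , λ 1≡0 → 0≢1 (sym 1≡0)) , λ ()
  more-rows-than-columns⇒relation {suc m} {suc r} r<m M with Finₚ.all? (λ i → M i zero Finₚ.≟ 0#)
  ... | yes column₀≡0 with more-rows-than-columns⇒relation (ℕₚ.m<n⇒m<1+n (ℕ.s<s⁻¹ r<m)) (λ i k → M i (suc k))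
  ...   | c , nontrivial , relation = c , nontrivial , λ where
            zero    → sum-zero _ (λ i → trans (cong (c i *_) (column₀≡0 i)) (zeroʳ (c i)))
            (suc k) → relation k
  more-rows-than-columns⇒relation {suc m} {suc r} r<m M | no ¬column₀≡0
    with Finₚ.¬∀⟶∃¬ (suc m) _ (λ i → M i zero Finₚ.≟ 0#) ¬column₀≡0
  ... | p , a≢0 with inverse (M p zero) a≢0
  ...   | a⁻¹ , aa⁻¹≡1 with more-rows-than-columns⇒relation (ℕ.s<s⁻¹ r<m) _
  ...     | d , nontrivial , relation = pivot-relation M p a⁻¹ aa⁻¹≡1 d nontrivial relation

  linIndep-in-span⇒≤ : ∀ {d r m} (b : Fin r → V F d) (y : Fin m → V F d) → LinIndep F y →
                       (∀ i → ∃[ a ] lincomb F a b ≡ y i) → m ≤ r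
  linIndep-in-span⇒≤ {d} {r} {m} b y independent in-span with m ℕₚ.≤? r
  ... | yes m≤r = m≤r
  ... | no m≰r with more-rows-than-columns⇒relation (ℕₚ.≰⇒> m≰r) (λ i → proj₁ (in-span i))
  ...   | c , (i , cᵢ≢0) , relation =
    ⊥-elim (cᵢ≢0 (independent c (lookup-extensionality coordinate-vanishes) i))
    where
    A = λ i → proj₁ (in-span i)
    coordinate-vanishes : ∀ l → lookup (lincomb F c y) l ≡ lookup (zeroV F d) l
    coordinate-vanishes l = begin
      apply ℓ (lincomb F c y)                                   ≡⟨ apply-lincomb ℓ c y ⟩
      ∑[ i < m ] (c i * apply ℓ (y i))                          ≡⟨ sum-cong-≗ (λ i → cong (λ v → c i * apply ℓ v) (sym (proj₂ (in-span i)))) ⟩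
      ∑[ i < m ] (c i * apply ℓ (lincomb F (A i) b))            ≡⟨ sum-cong-≗ (λ i → cong (c i *_) (apply-lincomb ℓ (A i) b)) ⟩
      ∑[ i < m ] (c i * ∑[ k < r ] (A i k * apply ℓ (b k)))     ≡⟨ sum-cong-≗ (λ i → *-distribˡ-sum (c i) (λ k → A i k * apply ℓ (b k))) ⟩
      ∑[ i < m ] ∑[ k < r ] (c i * (A i k * apply ℓ (b k)))     ≡⟨ ∑-comm (λ i k → c i * (A i k * apply ℓ (b k))) ⟩
      ∑[ k < r ] ∑[ i < m ] (c i * (A i k * apply ℓ (b k)))     ≡⟨ sum-cong-≗ (λ k → sym (trans (*-distribʳ-sum _ (λ i → c i * A i k))
                                                                     (sum-cong-≗ (λ i → *-assoc (c i) (A i k) _)))) ⟩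
      ∑[ k < r ] (∑[ i < m ] (c i * A i k) * apply ℓ (b k))     ≡⟨ sum-zero _ (λ k → trans (cong (_* _) (relation k)) (zeroˡ _)) ⟩
      0#                                                        ≡⟨ sym (0-homo ℓ) ⟩
      apply ℓ (zeroV F d)                                       ∎
      where ℓ = coordinate l

  fallingStar⇒init-linIndep : ∀ {d t} (s : Fin (suc t) → V F (suc d)) → (∀ k → AllNonzero F (s k)) →
                              FallingStar F s → LinIndep F (λ k → s (inject₁ k))
  fallingStar⇒init-linIndep {t = t} s s≢0 (injective , α , falling) =
    fallingStar-with-apex⇒linIndep (λ k → s (inject₁ k)) (s (Fin.fromℕ t)) (α (Fin.fromℕ t))
      (λ k → s≢0 (inject₁ k)) (s≢0 (Fin.fromℕ t)) init-star
      (λ j sₜ≡sⱼ → Finₚ.fromℕ≢inject₁ (injective sₜ≡sⱼ))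
      (λ j → falling (Fin.fromℕ t) (inject₁ j) (inject₁<fromℕ j))
    where
    inject₁<fromℕ : ∀ j → inject₁ j Fin.< Fin.fromℕ t
    inject₁<fromℕ j = subst (Fin.toℕ (inject₁ j) ℕ.<_) (sym (Finₚ.toℕ-fromℕ t)) (Finₚ.inject₁ℕ< j)

    init-star : FallingStar F (λ k → s (inject₁ k))
    init-star = (λ sᵢ≡sⱼ → Finₚ.inject₁-injective (injective sᵢ≡sⱼ)) , (λ k → α (inject₁ k)) ,
                λ i j j<i → falling (inject₁ i) (inject₁ j)
                                    (subst₂ ℕ._<_ (sym (Finₚ.toℕ-inject₁ j)) (sym (Finₚ.toℕ-inject₁ i)) j<i)

corollary1 : ∀ (q : ℕ) → OddPrimePower q → (F : FieldOn q) → (d : ℕ) → 1 ≤ d →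
    ((t : ℕ) (s : Fin (suc t) → V F d) → (∀ k → AllNonzero F (s k)) →
    FallingStar F s → LinIndep F (λ k → s (inject₁ k)))
    × ((T : Pred (V F d) 0ℓ) → SubsetNonzero F T → (r f : ℕ) →
    IsRank F T r → IsFS F T f → f ∸ 1 ≤ r)
    × ((T : Pred (V F d) 0ℓ) → SubsetNonzero F T →
    (v : V F d) → AllNonzero F v → ¬ T v →
    (γ : Color F d) → (∀ x → T x → φ F v x ≡ γ) →
    (r f : ℕ) → IsRank F T r → IsFS F T f → f ≤ r)
corollary1 q _ F (suc d) _ =
    (λ t s s≢0 star → fallingStar⇒init-linIndep F s s≢0 star)
  , (λ where
      T T≢0 r zero    _ _ → ℕ.z≤n
      T T≢0 r (suc t) (b , _ , _ , spans) ((s , s∈T , star) , _) →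
        linIndep-in-span⇒≤ F b (λ k → s (inject₁ k))
          (fallingStar⇒init-linIndep F s (λ k → T≢0 (s k) (s∈T k)) star)
          (λ k → spans (s (inject₁ k)) (s∈T (inject₁ k))))
  , λ T T≢0 v v≢0 v∉T γ monochromatic r f (b , _ , _ , spans) ((s , s∈T , star) , _) →
      linIndep-in-span⇒≤ F b s
        (fallingStar-with-apex⇒linIndep F s v γ (λ k → T≢0 (s k) (s∈T k)) v≢0 star
          (λ j v≡sⱼ → v∉T (subst T (sym v≡sⱼ) (s∈T j)))
          (λ j → monochromatic (s j) (s∈T j)))
        (λ k → spans (s k) (s∈T k))
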